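{- Let $G$ be a simple plane triangulation and let $v_1,\dots,v_6$ be vertices of $G$ such that $v_1,\dots,v_5$ induce a 5-cycle $v_1v_2v_3v_4v_5$, $v_6$ is adjacent to all of $v_1,\dots,v_5$, $d_G(v_6)=5$, and the multiset $\{d_G(v_1),\dots,d_G(v_5)\}$ equals $\{6,6,6,7,8\}$. Let $H$ be the wheel on $v_1,\dots,v_6$ (the 5-cycle together with the five edges $v_6v_i$). Then the configuration $(H, d_G|_{V(H)}, \Pi_H)$ is $1/6$-reducible.
   Context: A simple plane triangulation is a simple planar graph embedded in the sphere all of whose faces are triangles; $d_G(v)$ is the degree of $v$ in $G$. A configuration in $G$ is a triple $(H, d_G|_{V(H)}, \Pi_H)$ with $H$ a connected subgraph of $G$, the $G$-degrees of its vertices, and the rotation (cyclic order of $G$-edges, non-$H$ edges as half-edges) at each vertex of $H$. For a finite graph $H$ and $\delta: V(H)\to\mathbb{Z}$, the pair $(H,\delta)$ is $0$-reducible if the vertices of $H$ can be listed $w_1,\dots,w_n$ with $\delta(w_t) - |\{s<t : w_sw_t \in E(H)\}| \le 4$ for all $t$. A configuration with $|V(H)|\ge 6$ is $1/6$-reducible if there is a sequence of distinct vertices $v'_1,\dots,v'_k$ of $H$ such that: (i) for every $i$ for which $d_G(v'_j) > \deg_H(v'_j)$ for all $j<i$, the pair $(H - v'_i, \delta_i)$ is $0$-reducible, where $\delta_i(w) = d_G(w) - [wv'_i \in E(H)] - [w \in \{v'_1,\dots,v'_{i-1}\}]$; and (ii) if $d_G(v'_j) > \deg_H(v'_j)$ for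 all $j\le k$, then $(H,\delta_*)$ is $0$-reducible, where $\delta_*(w) = d_G(w) - [w \in \{v'_1,\dots,v'_k\}]$. -}

module Defs where

open import Data.Nat using (ℕ; zero; suc; _+_; _*_; _≤_; _<_; _%_; _/_; _≡ᵇ_)
open import Data.Integer as ℤ using (ℤ; +_)
open import Data.Bool using (Bool; true; false; if_then_else_; _∨_; not)
open import Data.Fin using (Fin; toℕ; inject₁; _≟_)
open import Data.List using (List; []; _∷_; map; filter; allFin)
open import Data.Nat.ListAction using (sum)
open import Data.Bool.ListAction using (any)
open import Data.List.Relation.Unary.Unique.Propositional using (Unique)
open import Data.List.Relation.Binary.Permutation.Propositional using (_↭_)
open import Data.Product using (Σ; _×_; ∃)
open import Data.Unit using (⊤)
open import Function using (_∘_)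
open import Relation.Nullary using (¬?)
open import Relation.Nullary.Decidable using (⌊_⌋)
open import Relation.Binary.PropositionalEquality using (_≡_)

ind : Bool → ℕ
ind b = if b then 1 else 0

record SimpleGraph (n : ℕ) : Set where
  field
    adj    : Fin n → Fin n → Bool
    sym    : ∀ u v → adj u v ≡ adj v u
    irrefl : ∀ v → adj v v ≡ false

  deg : Fin n → ℕ
  deg v = sum (map (λ w → ind (adj v w)) (allFin n))

  -- darts = ordered pairs (u,v) with uv an edge; their number is Σ deg
  numDarts : ℕ
  numDarts = sum (map deg (allFin n))

  numEdges : ℕ
  numEdges = numDarts / 2

  data Reach : Fin n → Fin n → Set where
    here : ∀ {u} → Reach u u
    step : ∀ {u v w} → adj u v ≡ true → Reach v w → Reach u w

iter : ∀ {A : Set} → (A → A) → ℕ → A → A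
iter f zero x = x
iter f (suc k) x = f (iter f k x)

-- Simple plane triangulation, given combinatorially: a connected simple
-- graph with a rotation system (rot v = cyclic successor in the rotation
-- at v) all of whose faces (orbits of the dart map (u,v) ↦ (v, rot v u))
-- are triangles, and satisfying Euler's formula V - E + F = 2 (so the
-- embedding surface is the sphere).  Since every face consists of exactly
-- 3 darts, F = numDarts / 3.

record PlaneTriangulation (n : ℕ) : Set where
  field
    graph : SimpleGraph n
  open SimpleGraph graph public
  field
    connected  : ∀ u w → Reach u w
    rot        : Fin n → Fin n → Fin n
    rot-nbr    : ∀ v w → adj v w ≡ true → adj v (rot v w) ≡ true
    rot-cyclic : ∀ v w w′ → adj v w ≡ true → adj v w′ ≡ true →
                 ∃ λ k → iter (rot v) k w ≡ w′
    triangular : ∀ u v → adj u v ≡ true →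
                 rot (rot v u) v ≡ u × rot u (rot v u) ≡ v
    euler      : n + numDarts / 3 ≡ numEdges + 2

-- The wheel W5 on Fin 6: indices 0..4 are the rim v1..v5 (cycle
-- v1v2v3v4v5 in this order), index 5 is the hub v6.

cycℕ : ℕ → ℕ → Bool
cycℕ a b = (suc a % 5 ≡ᵇ b) ∨ (suc b % 5 ≡ᵇ a)

wheelℕ : ℕ → ℕ → Bool
wheelℕ a b = if a ≡ᵇ 5 then not (b ≡ᵇ 5)
             else (if b ≡ᵇ 5 then true else cycℕ a b)

wheel : Fin 6 → Fin 6 → Bool
wheel i j = wheelℕ (toℕ i) (toℕ j)

rim : List (Fin 6)
rim = map inject₁ (allFin 5)

-- 0-reducibility and 1/6-reducibility of (H, d) with H a graph on Fin m
-- (given by its adjacency H) and d the G-degrees of the vertices of H.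

module Reducibility {m : ℕ} (H : Fin m → Fin m → Bool) (d : Fin m → ℕ) where

  degH : Fin m → ℕ
  degH v = sum (map (λ w → ind (H v w)) (allFin m))

  earlierNbrs : Fin m → List (Fin m) → ℕ
  earlierNbrs w prefix = sum (map (λ s → ind (H s w)) prefix)

  Ordered : (Fin m → ℤ) → List (Fin m) → List (Fin m) → Set
  Ordered δ prefix [] = ⊤
  Ordered δ prefix (w ∷ ws) =
    (δ w ℤ.- + earlierNbrs w prefix ℤ.≤ + 4) × Ordered δ (w ∷ prefix) ws

  ZeroReducible : List (Fin m) → (Fin m → ℤ) → Set
  ZeroReducible vs δ = Σ (List (Fin m)) λ ws → (ws ↭ vs) × Ordered δ [] ws

  allV : List (Fin m)
  allV = allFin m

  minus : Fin m → List (Fin m)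
  minus v = filter (λ w → ¬? (w ≟ v)) (allFin m)

  mem : Fin m → List (Fin m) → Bool
  mem w xs = any (λ x → ⌊ x ≟ w ⌋) xs

  -- Aux prefix rest: prefix = v'_1..v'_{i-1} (all with d > deg_H),
  -- rest = v'_i .. v'_k.  Conditions (i) and (ii) of the definition.
  Aux : List (Fin m) → List (Fin m) → Set
  Aux prefix [] =
    ZeroReducible allV (λ w → + d w ℤ.- + ind (mem w prefix))
  Aux prefix (v ∷ rest) =
    ZeroReducible (minus v)
      (λ w → + d w ℤ.- + ind (H w v) ℤ.- + ind (mem w prefix))
    × (degH v < d v → Aux (v ∷ prefix) rest)

  SixthReducible : Set
  SixthReducible = (6 ≤ m) × Σ (List (Fin m)) λ vs → Unique vs × Aux [] vs

open Reducibility public using (SixthReducible)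

{-# OPTIONS --safe #-}
-- Remove the rim vertex of degree 8, then the one of degree 7, then one of degree 6, and
-- finally the hub. While a rim vertex is removed, the hub has reduced degree 4 and is listed
-- first, after which the rest of the rim is a path that can be listed from its ends inwards;
-- once the hub is removed, the rim cycle is listed starting from the degree-6 vertex removed
-- before. The hub has d = deg_H = 5, so the sequence stops there and condition (ii) is vacuous.
-- The rim degrees may be arranged in any order, so every permutation of 6,6,6,7,8 is checked.
module Submission where

open import Defs
open import Data.Bool using (Bool)
open import Data.Nat as ℕ using (ℕ; zero; suc; _<?_; _≤?_)
open import Data.Fin as Fin using (Fin; zero; suc; fromℕ; toℕ)
open import Data.Integer as ℤ using (ℤ; +_)
open import Data.List using (List; []; _∷_; [_]; _++_; map; concatMap; filter; take; drop; head; length)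
open import Data.List.Relation.Binary.Permutation.Propositional using (_↭_; ↭-refl; ↭-sym; ↭-trans; prep)
open import Data.List.Relation.Binary.Permutation.Propositional.Properties using (shift; drop-mid; ∈-resp-↭; ↭-empty-inv)
open import Data.List.Relation.Unary.Any using (here; there; any?)
open import Data.List.Relation.Unary.All as All using (All)
open import Data.List.Relation.Unary.Unique.DecPropositional using (unique?)
open import Data.List.Membership.Propositional using (_∈_; find)
open import Data.List.Membership.Propositional.Properties using (∈-∃++; ∈-map⁺; ∈-concat⁺′)
open import Data.Maybe using (Maybe; just; nothing; fromMaybe; from-just)
open import Data.Maybe.Effectful using (applicative)
open import Data.Product using (∃; _×_; _,_)
open import Data.Unit using (tt)
open import Data.Empty using (⊥-elim)
open import Function using (_∘_)
open import Function.Definitions using (Injective)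
open import Level using (0ℓ)
open import Relation.Nullary using (Dec; yes; no)
open import Relation.Unary using (Pred)
open import Relation.Binary.PropositionalEquality using (_≡_; _≗_; refl; sym; cong; subst)

module _ {A : Set} where

  insertions : A → List A → List (List A)
  insertions x []       = [ [ x ] ]
  insertions x (y ∷ ys) = (x ∷ y ∷ ys) ∷ map (y ∷_) (insertions x ys)

  permutations : List A → List (List A)
  permutations []       = [ [] ]
  permutations (x ∷ xs) = concatMap (insertions x) (permutations xs)

  ∈-insertions : ∀ {x} as bs → as ++ x ∷ bs ∈ insertions x (as ++ bs)
  ∈-insertions []       []       = here refl
  ∈-insertions []       (b ∷ bs) = here refl
  ∈-insertions (a ∷ as) bs       = there (∈-map⁺ (a ∷_) (∈-insertions as bs))

  ↭⇒∈permutations : ∀ {xs} ys → xs ↭ ys → xs ∈ permutations ys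
  ↭⇒∈permutations []       xs↭[] rewrite ↭-empty-inv xs↭[] = here refl
  ↭⇒∈permutations (y ∷ ys) xs↭y∷ys
    with as , bs , refl ← ∈-∃++ (∈-resp-↭ (↭-sym xs↭y∷ys) (here refl)) =
    ∈-concat⁺′ (∈-insertions as bs)
      (∈-map⁺ (insertions y) (↭⇒∈permutations ys (drop-mid as [] xs↭y∷ys)))

module Search {m : ℕ} (H : Fin m → Fin m → Bool) (d : Fin m → ℕ) where

  open Reducibility H d hiding (SixthReducible)

  listable? : (δ : Fin m → ℤ) (prefix : List (Fin m)) (w : Fin m) →
              Dec (δ w ℤ.- + earlierNbrs w prefix ℤ.≤ + 4)
  listable? δ prefix w = δ w ℤ.- + earlierNbrs w prefix ℤ.≤? + 4

  -- Listing a vertex only makes the others more listable, so greedy listing fails only when no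
  -- order exists; each unit of fuel pays for one listed vertex.
  greedyOrder : ℕ → (δ : Fin m → ℤ) (prefix rest : List (Fin m)) →
                Maybe (∃ λ ws → ws ↭ rest × Ordered δ prefix ws)
  greedyOrder _          δ prefix []      = just ([] , ↭-refl , tt)
  greedyOrder zero       δ prefix (_ ∷ _) = nothing
  greedyOrder (suc fuel) δ prefix rest with any? (listable? δ prefix) rest
  ... | no _ = nothing
  ... | yes ∃listable with w , w∈rest , w-listable ← find ∃listable
                      with as , bs , refl ← ∈-∃++ w∈rest
                      with greedyOrder fuel δ (w ∷ prefix) (as ++ bs)
  ...   | nothing = nothing
  ...   | just (ws , ws↭ , ordered) =
          just (w ∷ ws , ↭-trans (prep w ws↭) (↭-sym (shift w as bs)) , w-listable , ordered)

  greedyZeroReducible : ∀ vs δ → Maybe (ZeroReducible vs δ)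
  greedyZeroReducible vs δ = greedyOrder (length vs) δ [] vs

  auxBy : ∀ prefix rest → Maybe (Aux prefix rest)
  auxBy prefix [] = greedyZeroReducible allV _
  auxBy prefix (v ∷ rest) with greedyZeroReducible (minus v) _ | degH v <? d v
  ... | nothing | _        = nothing
  ... | just zr | no  ¬lt  = just (zr , λ lt → ⊥-elim (¬lt lt))
  ... | just zr | yes _    with auxBy (v ∷ prefix) rest
  ...   | nothing = nothing
  ...   | just a  = just (zr , λ _ → a)

  sixthReducibleBy : List (Fin m) → Maybe (SixthReducible H d)
  sixthReducibleBy vs with 6 ≤? m | unique? Fin._≟_ vs | auxBy [] vs
  ... | yes 6≤m | yes unique | just a = just (6≤m , vs , unique , a)
  ... | _       | _          | _      = nothing

module _ {m : ℕ} (H : Fin m → Fin m → Bool) {d d′ : Fin m → ℕ} (d≗d′ : d ≗ d′) where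

  private
    module R  = Reducibility H d
    module R′ = Reducibility H d′

  Ordered-resp-≗ : ∀ {δ δ′} → δ ≗ δ′ → ∀ prefix ws → R.Ordered δ prefix ws → R′.Ordered δ′ prefix ws
  Ordered-resp-≗ δ≗δ′ prefix []       tt              = tt
  Ordered-resp-≗ δ≗δ′ prefix (w ∷ ws) (listable , os) =
    subst (λ x → x ℤ.- _ ℤ.≤ _) (δ≗δ′ w) listable , Ordered-resp-≗ δ≗δ′ (w ∷ prefix) ws os

  ZeroReducible-resp-≗ : ∀ {vs δ δ′} → δ ≗ δ′ → R.ZeroReducible vs δ → R′.ZeroReducible vs δ′
  ZeroReducible-resp-≗ δ≗δ′ (ws , ws↭vs , ordered) = ws , ws↭vs , Ordered-resp-≗ δ≗δ′ [] ws ordered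

  Aux-resp-≗ : ∀ prefix rest → R.Aux prefix rest → R′.Aux prefix rest
  Aux-resp-≗ prefix [] zr =
    ZeroReducible-resp-≗ (λ w → cong (λ x → + x ℤ.- + ind (R.mem w prefix)) (d≗d′ w)) zr
  Aux-resp-≗ prefix (v ∷ rest) (zr , continue) =
    ZeroReducible-resp-≗ (λ w → cong (λ x → + x ℤ.- + ind (H w v) ℤ.- + ind (R.mem w prefix)) (d≗d′ w)) zr ,
    λ lt → Aux-resp-≗ (v ∷ prefix) rest (continue (subst (_ ℕ.<_) (sym (d≗d′ v)) lt))

  SixthReducible-resp-≗ : SixthReducible H d → SixthReducible H d′
  SixthReducible-resp-≗ (6≤m , vs , unique , aux) = 6≤m , vs , unique , Aux-resp-≗ [] vs aux

hub : Fin 6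
hub = fromℕ 5

-- ds lists the degrees of v1..v5; the hub index 5 runs off the list and gets the default 5.
withHub : List ℕ → Fin 6 → ℕ
withHub ds i = fromMaybe 5 (head (drop (toℕ i) ds))

removalOrder : (Fin 6 → ℕ) → List (Fin 6)
removalOrder d = ofDegree 8 ++ ofDegree 7 ++ take 1 (ofDegree 6) ++ [ hub ]
  where
    ofDegree : ℕ → List (Fin 6)
    ofDegree k = filter (λ i → d i ℕ.≟ k) rim

ReducibleArrangement : Pred (List ℕ) 0ℓ
ReducibleArrangement ds = SixthReducible wheel (withHub ds)

rimDegrees : List ℕ
rimDegrees = 6 ∷ 6 ∷ 6 ∷ 7 ∷ 8 ∷ []

arrangements-reducible : All ReducibleArrangement (permutations rimDegrees)
-- This type-checks only because every certificate normalises to just.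
arrangements-reducible =
  from-just (All.sequenceA 0ℓ applicative (All.tabulate {xs = permutations rimDegrees} λ {ds} _ → certificate ds))
  where
    certificate : ∀ ds → Maybe (ReducibleArrangement ds)
    certificate ds = Search.sixthReducibleBy wheel (withHub ds) (removalOrder (withHub ds))

lemma3p5 : ∀ {n : ℕ} (T : PlaneTriangulation n) (v : Fin 6 → Fin n) →
    Injective _≡_ _≡_ v →
    (∀ i j → PlaneTriangulation.adj T (v i) (v j) ≡ wheel i j) →
    PlaneTriangulation.deg T (v (fromℕ 5)) ≡ 5 →
    map (PlaneTriangulation.deg T ∘ v) rim ↭ (6 ∷ 6 ∷ 6 ∷ 7 ∷ 8 ∷ []) →
    SixthReducible wheel (PlaneTriangulation.deg T ∘ v)
-- Reducibility only sees H = wheel and the degrees.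
lemma3p5 T v _ _ hub-degree rim↭ =
  SixthReducible-resp-≗ wheel withHub-rimDegrees
    (All.lookup arrangements-reducible (↭⇒∈permutations _ rim↭))
  where
    D : Fin 6 → ℕ
    D = PlaneTriangulation.deg T ∘ v

    withHub-rimDegrees : withHub (map D rim) ≗ D
    withHub-rimDegrees zero                                = refl
    withHub-rimDegrees (suc zero)                          = refl
    withHub-rimDegrees (suc (suc zero))                    = refl
    withHub-rimDegrees (suc (suc (suc zero)))              = refl
    withHub-rimDegrees (suc (suc (suc (suc zero))))        = refl
    withHub-rimDegrees (suc (suc (suc (suc (suc zero))))) = sym hub-degree
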